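{- Let $G$ be a connected MP-digraph and let $G_1,\dots,G_k$ be its dynamical modules. Then $M_G=M_{G_1}\oplus\cdots\oplus M_{G_k}$.
   Context: Digraphs: finite, at most one edge $(v,w)$ from $v$ to $w$ for distinct $v,w$, loops allowed. A multipath is a spanning subgraph each of whose connected components is a vertex or a simple path (sequence of non-loop edges, target of each = source of next, no repeated vertex, not closing into a cycle); $M_H=(E(H),\mathrm{Mult}(H))$ with multipaths as edge sets. An MP-digraph satisfies (MP1) no subgraph isomorphic to $D_A$ (vertices $v_0,v_1,v_2$, edges $(v_1,v_0),(v_0,v_2),(v_1,v_2)$) or $D_B$ (vertices $v_0,\dots,v_3$, edges $(v_0,v_1),(v_2,v_1),(v_2,v_3)$) or their edge-reversals, and (MP2) every coherently oriented cycle of length $\ge2$ is a connected component; then $M_H$ is a matroid for $H$ an MP-digraph or a subgraph of one. For $G'\le G$: complement $C_G(G')$ is the subgraph spanned by $E(G)\setminus E(G')$; boundary $\partial G'=V(G')\cap V(C_G(G'))$. A vertex is stable if its indegree or outdegree is $0$, unstable otherwise. A dynamical region is a connected subgraph $R$ with at least one edge such that (a) every vertex of $\partial R$ is unstable in $G$ but stable in $R$ and in $C_G(R)$, (b) no edge of $R$ lies on an oriented cycle of $G$ not contained in $R$. A dynamical module is a minimal dynamical region. Direct sum of matroids: disjoint union of ground sets, independents disjoint unions of independents. -}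

module Defs where

open import Data.Nat using (ℕ; zero; suc)
open import Data.Fin using (Fin; zero; suc; inject₁; fromℕ)
open import Data.Bool using (Bool; true; false; T; _∧_; not)
open import Data.Product using (Σ; ∃; ∃-syntax; _×_; _,_)
open import Data.Sum using (_⊎_)
open import Data.List using (List; []; _∷_; map)
open import Data.List.Relation.Unary.All using (All)
open import Relation.Nullary using (¬_)
open import Relation.Binary.PropositionalEquality using (_≡_)
open import Relation.Binary.Construct.Closure.ReflexiveTransitive using (Star)
open import Function using (_⇔_)
open import Function.Definitions using (Injective)

-- Digraphs on vertex set Fin n.  An edge (v,w) is present iff edge v w
-- is true; at most one edge per ordered pair, loops (v,v) allowed.

record Digraph (n : ℕ) : Set where
  field
    edge : Fin n → Fin n → Bool

EdgeSet : ℕ → Set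
EdgeSet n = Fin n → Fin n → Bool

record Subgraph {n : ℕ} (G : Digraph n) : Set where
  field
    vert  : Fin n → Bool
    edge  : EdgeSet n
    edge⊆ : ∀ u v → T (edge u v) → T (Digraph.edge G u v)
    src∈  : ∀ u v → T (edge u v) → T (vert u)
    tgt∈  : ∀ u v → T (edge u v) → T (vert v)

open Subgraph public

_≤ₛ_ : ∀ {n} {G : Digraph n} → Subgraph G → Subgraph G → Set
R' ≤ₛ R = (∀ v → T (vert R' v) → T (vert R v))
        × (∀ u v → T (edge R' u v) → T (edge R u v))

_≈ₛ_ : ∀ {n} {G : Digraph n} → Subgraph G → Subgraph G → Set
R' ≈ₛ R = (∀ v → vert R' v ≡ vert R v) × (∀ u v → edge R' u v ≡ edge R u v)

Adj : ∀ {n} → EdgeSet n → Fin n → Fin n → Set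
Adj E a b = T (E a b) ⊎ T (E b a)

Connected : ∀ {n} → (Fin n → Bool) → EdgeSet n → Set
Connected {n} V E = ∀ (u v : Fin n) → T (V u) → T (V v) → Star (Adj E) u v

record Path {n : ℕ} (E : EdgeSet n) : Set where
  field
    len   : ℕ
    vtx   : Fin (suc len) → Fin n
    inj   : Injective _≡_ _≡_ vtx
    edges : ∀ (i : Fin len) → T (E (vtx (inject₁ i)) (vtx (suc i)))

OnPath : ∀ {n} {E : EdgeSet n} → Path E → Fin n → Set
OnPath P v = ∃[ i ] Path.vtx P i ≡ v

PathEdge : ∀ {n} {E : EdgeSet n} → Path E → Fin n → Fin n → Set
PathEdge P u v = ∃[ i ] (u ≡ Path.vtx P (inject₁ i) × v ≡ Path.vtx P (suc i))

-- A coherently oriented cycle f 0 → f 1 → … → f k → f 0 of length suc k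
-- (distinct vertices; length 1 = a loop).
record Cycle {n : ℕ} (E : EdgeSet n) : Set where
  field
    len   : ℕ
    vtx   : Fin (suc len) → Fin n
    inj   : Injective _≡_ _≡_ vtx
    edges : ∀ (i : Fin len) → T (E (vtx (inject₁ i)) (vtx (suc i)))
    close : T (E (vtx (fromℕ len)) (vtx zero))

OnCycle : ∀ {n} {E : EdgeSet n} → Cycle E → Fin n → Set
OnCycle c v = ∃[ i ] Cycle.vtx c i ≡ v

CycleEdge : ∀ {n} {E : EdgeSet n} → Cycle E → Fin n → Fin n → Set
CycleEdge c u v =
  (∃[ i ] (u ≡ Cycle.vtx c (inject₁ i) × v ≡ Cycle.vtx c (suc i)))
  ⊎ (u ≡ Cycle.vtx c (fromℕ (Cycle.len c)) × v ≡ Cycle.vtx c zero)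

-- For a graph H with vertex set V and edge set E, an edge
-- set S ⊆ E determines the spanning subgraph (V, S).  It is a multipath
-- iff every connected component is a vertex or a simple path, i.e. for
-- each vertex v of H there is a simple path P in S (length 0 = single
-- vertex) through v whose subgraph is the component of v: every edge of S
-- incident to a vertex of P is an edge of P.

IsMultipath : ∀ {n} → (Fin n → Bool) → EdgeSet n → EdgeSet n → Set
IsMultipath {n} V E S =
  (∀ u v → T (S u v) → T (E u v))
  × (∀ (v : Fin n) → T (V v) →
       Σ (Path S) λ P → OnPath P v
         × (∀ a b → T (S a b) → (OnPath P a ⊎ OnPath P b) → PathEdge P a b))

ContainsPattern : ∀ {n} → Digraph n → (m : ℕ) → List (Fin m × Fin m) → Set
ContainsPattern {n} G m es =
  Σ (Fin m → Fin n) λ f → Injective _≡_ _≡_ f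
    × All (λ { (a , b) → T (Digraph.edge G (f a) (f b)) }) es

reverseEdges : ∀ {m} → List (Fin m × Fin m) → List (Fin m × Fin m)
reverseEdges = map λ { (a , b) → (b , a) }

DA-edges : List (Fin 3 × Fin 3)
DA-edges = (suc zero , zero) ∷ (zero , suc (suc zero)) ∷ (suc zero , suc (suc zero)) ∷ []

DB-edges : List (Fin 4 × Fin 4)
DB-edges = (zero , suc zero) ∷ (suc (suc zero) , suc zero) ∷ (suc (suc zero) , suc (suc (suc zero))) ∷ []

MP1 : ∀ {n} → Digraph n → Set
MP1 G = ¬ ContainsPattern G 3 DA-edges × ¬ ContainsPattern G 3 (reverseEdges DA-edges)
      × ¬ ContainsPattern G 4 DB-edges × ¬ ContainsPattern G 4 (reverseEdges DB-edges)

-- every coherently oriented cycle of length ≥ 2 is a connected component: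
-- (it is connected and) every edge of G incident to one of its vertices
-- is one of its edges.
MP2 : ∀ {n} → Digraph n → Set
MP2 G = ∀ (c : Cycle (Digraph.edge G)) → 1 Data.Nat.≤ Cycle.len c →
        ∀ u v → T (Digraph.edge G u v) → (OnCycle c u ⊎ OnCycle c v) → CycleEdge c u v

MPDigraph : ∀ {n} → Digraph n → Set
MPDigraph G = MP1 G × MP2 G

module _ {n : ℕ} {G : Digraph n} (R : Subgraph G) where

  compEdge : EdgeSet n
  compEdge u v = Digraph.edge G u v ∧ not (edge R u v)

  InComp : Fin n → Set
  InComp v = ∃[ w ] (T (compEdge v w) ⊎ T (compEdge w v))

  Boundary : Fin n → Set
  Boundary v = T (vert R v) × InComp v

Stable : ∀ {n} → EdgeSet n → Fin n → Set
Stable E v = (∀ u → ¬ T (E u v)) ⊎ (∀ w → ¬ T (E v w))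

Unstable : ∀ {n} → EdgeSet n → Fin n → Set
Unstable E v = ¬ Stable E v

DynRegion : ∀ {n} {G : Digraph n} → Subgraph G → Set
DynRegion {n} {G} R =
  Connected (vert R) (edge R)
  × (∃[ u ] ∃[ v ] T (edge R u v))
  × (∀ v → Boundary R v →
       Unstable (Digraph.edge G) v × Stable (edge R) v × Stable (compEdge R) v)
  × (∀ u v → T (edge R u v) → (c : Cycle (Digraph.edge G)) → CycleEdge c u v →
       ∀ a b → CycleEdge c a b → T (edge R a b))

DynModule : ∀ {n} {G : Digraph n} → Subgraph G → Set
DynModule {G = G} R = DynRegion R × (∀ (R' : Subgraph G) → DynRegion R' → R' ≤ₛ R → R' ≈ₛ R)

-- M_G = M_{G_1} ⊕ ⋯ ⊕ M_{G_k}, with ground sets identified as subsets of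
-- E(G): E(G) is the disjoint union of the E(G_i), and S ⊆ E(G) is a
-- multipath of G iff S is a union of multipaths I_i of the G_i.

allV : ∀ {n} → Fin n → Bool
allV _ = true

DirectSumOfModules : ∀ {n} (G : Digraph n) (k : ℕ) → (Fin k → Subgraph G) → Set
DirectSumOfModules {n} G k Gs =
  (∀ u v → T (Digraph.edge G u v) → ∃[ i ] T (edge (Gs i) u v))
  × (∀ i j u v → T (edge (Gs i) u v) → T (edge (Gs j) u v) → i ≡ j)
  × (∀ (S : EdgeSet n) → (∀ u v → T (S u v) → T (Digraph.edge G u v)) →
       IsMultipath allV (Digraph.edge G) S
       ⇔ (Σ (Fin k → EdgeSet n) λ I →
            (∀ i → IsMultipath (vert (Gs i)) (edge (Gs i)) (I i))
            × (∀ u v → T (S u v) ⇔ (∃[ i ] T (I i u v)))))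

-- Call two arcs coupled if they share their source, or share their target, or if the
-- head of one is the tail of the other at a vertex lying on an oriented cycle.  Condition
-- (a) on the boundary forces a dynamical region containing an arc to contain every arc
-- sharing its source or target, and with condition (b) also every arc coupled to it
-- through a cycle.  Conversely, the class of an arc under the equivalence generated by
-- coupling is itself a dynamical region, hence the least one containing the arc.  So the
-- dynamical modules are exactly these classes and they partition E(G).
-- A set of arcs is a multipath iff it has in- and out-degree at most one and no oriented
-- cycle.  Arcs with a common source or target, and all arcs of a cycle, lie in a single
-- module, so these local conditions hold for S iff they hold for every S ∩ E(Gᵢ).

{-# OPTIONS --safe #-}
module Submission where

open import Defs
open import Data.Nat using (ℕ; zero; suc; _+_; _≤_; _<_)
open import Data.Nat.Properties using (+-suc; +-identityʳ; m≤n+m; <⇒≱; m≢1+m+n)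
open import Data.Fin using (Fin; zero; suc; inject₁; fromℕ; toℕ; punchOut)
open import Data.Fin.Properties
  using (_≟_; any?; injective⇒≤; 0≢1+n; fromℕ≢inject₁; inject₁-injective; toℕ-inject₁;
         punchIn-punchOut; punchOut-injective)
open import Data.Vec.Functional using (Vector; insertAt; tail)
open import Data.Vec.Functional.Properties using (insertAt-lookup; insertAt-punchIn)
open import Data.Bool using (Bool; true; false; T; _∧_)
open import Data.Bool.Properties using (T?; T-∧; ∧-identityʳ)
open import Data.Unit using (⊤; tt)
open import Data.Product using (Σ; ∃; ∃-syntax; _×_; _,_; proj₁; proj₂)
open import Data.Sum using (_⊎_; inj₁; inj₂; [_,_])
open import Data.Empty using (⊥-elim)
open import Relation.Binary.Construct.Closure.ReflexiveTransitive using (Star; ε; _◅_; _◅◅_; reverse)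
open import Relation.Nullary using (¬_; Dec; yes; no)
open import Relation.Nullary.Decidable using (isYes; toWitness; fromWitness; toWitnessFalse; _⊎-dec_; decidable-stable; ¬¬-excluded-middle)
open import Relation.Binary.PropositionalEquality using (_≡_; _≢_; refl; sym; trans; cong; subst; subst₂)
open import Function using (_⇔_; mk⇔; Equivalence; _∘_)
open import Function.Definitions using (Injective)

¬¬-∀-Fin : ∀ m {P : Fin m → Set} → (∀ i → ¬ ¬ P i) → ¬ ¬ (∀ i → P i)
¬¬-∀-Fin zero    _   ¬∀ = ¬∀ λ ()
¬¬-∀-Fin (suc m) ¬¬P ¬∀ =
  ¬¬P zero λ p₀ → ¬¬-∀-Fin m (¬¬P ∘ suc) λ p → ¬∀ λ { zero → p₀ ; (suc i) → p i }

T-antisym : ∀ {x y} → (T x → T y) → (T y → T x) → x ≡ y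
T-antisym {false} {false} _ _ = refl
T-antisym {false} {true}  _ g = ⊥-elim (g tt)
T-antisym {true}  {false} f _ = ⊥-elim (f tt)
T-antisym {true}  {true}  _ _ = refl

fromℕ-or-inject₁ : ∀ {m} (i : Fin (suc m)) → i ≡ fromℕ m ⊎ ∃ λ j → i ≡ inject₁ j
fromℕ-or-inject₁ {zero}  zero    = inj₁ refl
fromℕ-or-inject₁ {suc m} zero    = inj₂ (zero , refl)
fromℕ-or-inject₁ {suc m} (suc i) with fromℕ-or-inject₁ i
... | inj₁ eq       = inj₁ (cong suc eq)
... | inj₂ (j , eq) = inj₂ (suc j , cong suc eq)

module _ {a} {A : Set a} where

  insertAt-punchOut : ∀ {m} (xs : Vector A m) {i j} v (i≢j : i ≢ j) →
                      insertAt xs i v j ≡ xs (punchOut i≢j)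
  insertAt-punchOut xs {i} v i≢j =
    trans (cong (insertAt xs i v) (sym (punchIn-punchOut i≢j))) (insertAt-punchIn xs i v _)

  insertAt-injective : ∀ {m} (xs : Vector A m) i v → Injective _≡_ _≡_ xs →
                       (∀ j → xs j ≢ v) → Injective _≡_ _≡_ (insertAt xs i v)
  insertAt-injective xs i v inj fresh {x} {y} eq with i ≟ x | i ≟ y
  ... | yes refl | yes refl = refl
  ... | yes refl | no i≢y   =
    ⊥-elim (fresh _ (trans (sym (insertAt-punchOut xs v i≢y)) (trans (sym eq) (insertAt-lookup xs i v))))
  ... | no i≢x   | yes refl =
    ⊥-elim (fresh _ (trans (sym (insertAt-punchOut xs v i≢x)) (trans eq (insertAt-lookup xs i v))))
  ... | no i≢x   | no i≢y   =
    punchOut-injective i≢x i≢y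
      (inj (trans (sym (insertAt-punchOut xs v i≢x)) (trans eq (insertAt-punchOut xs v i≢y))))

  insertAt-fromℕ-inject₁ : ∀ {m} (xs : Vector A m) v j → insertAt xs (fromℕ m) v (inject₁ j) ≡ xs j
  insertAt-fromℕ-inject₁ {suc m} xs v zero    = refl
  insertAt-fromℕ-inject₁ {suc m} xs v (suc j) = insertAt-fromℕ-inject₁ (tail xs) v j

≤ₛ-antisym : ∀ {n} {G : Digraph n} {R R′ : Subgraph G} → R ≤ₛ R′ → R′ ≤ₛ R → R ≈ₛ R′
≤ₛ-antisym (vert≤ , edge≤) (vert≥ , edge≥) =
  (λ v → T-antisym (vert≤ v) (vert≥ v)) , (λ a b → T-antisym (edge≤ a b) (edge≥ a b))

≈ₛ-sym : ∀ {n} {G : Digraph n} {R R′ : Subgraph G} → R ≈ₛ R′ → R′ ≈ₛ R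
≈ₛ-sym (vert≡ , edge≡) = (λ v → sym (vert≡ v)) , (λ a b → sym (edge≡ a b))

≈ₛ-trans : ∀ {n} {G : Digraph n} {R R′ R″ : Subgraph G} → R ≈ₛ R′ → R′ ≈ₛ R″ → R ≈ₛ R″
≈ₛ-trans (vert≡ , edge≡) (vert≡′ , edge≡′) =
  (λ v → trans (vert≡ v) (vert≡′ v)) , (λ a b → trans (edge≡ a b) (edge≡′ a b))

-- Multipaths as linear forests

_⊆ₑ_ : ∀ {n} → EdgeSet n → EdgeSet n → Set
S ⊆ₑ E = ∀ u v → T (S u v) → T (E u v)

_∩ₑ_ : ∀ {n} → EdgeSet n → EdgeSet n → EdgeSet n
(S ∩ₑ E) u v = S u v ∧ E u v

module _ {n} {E : EdgeSet n} where

  cycleEdge-edge : (c : Cycle E) → ∀ {a b} → CycleEdge c a b → T (E a b)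
  cycleEdge-edge c (inj₁ (i , refl , refl)) = Cycle.edges c i
  cycleEdge-edge c (inj₂ (refl , refl))     = Cycle.close c

  cycle-in-arc : (c : Cycle E) → ∀ j → ∃ λ u → CycleEdge c u (Cycle.vtx c j)
  cycle-in-arc c zero    = _ , inj₂ (refl , refl)
  cycle-in-arc c (suc j) = _ , inj₁ (j , refl , refl)

  cycle-out-arc : (c : Cycle E) → ∀ j → ∃ λ w → CycleEdge c (Cycle.vtx c j) w
  cycle-out-arc c j with fromℕ-or-inject₁ j
  ... | inj₁ refl       = _ , inj₂ (refl , refl)
  ... | inj₂ (i , refl) = _ , inj₁ (i , refl , refl)

  cycle-restrict : ∀ {F} (c : Cycle E) → (∀ {a b} → CycleEdge c a b → T (F a b)) → Cycle F
  cycle-restrict c inF = record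
    { len = Cycle.len c ; vtx = Cycle.vtx c ; inj = Cycle.inj c
    ; edges = λ i → inF (inj₁ (i , refl , refl)) ; close = inF (inj₂ (refl , refl)) }

  cycle-mono : ∀ {F} → E ⊆ₑ F → Cycle E → Cycle F
  cycle-mono E⊆F c = cycle-restrict c (E⊆F _ _ ∘ cycleEdge-edge c)

record IsLinearForest {n} (S : EdgeSet n) : Set where
  field
    out-unique : ∀ {u v w} → T (S u v) → T (S u w) → v ≡ w
    in-unique  : ∀ {u v w} → T (S u w) → T (S v w) → u ≡ v
    acyclic    : ¬ Cycle S

isLinearForest-mono : ∀ {n} {S S′ : EdgeSet n} → S′ ⊆ₑ S → IsLinearForest S → IsLinearForest S′
isLinearForest-mono S′⊆S lf = record
  { out-unique = λ s t → out-unique (S′⊆S _ _ s) (S′⊆S _ _ t)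
  ; in-unique  = λ s t → in-unique (S′⊆S _ _ s) (S′⊆S _ _ t)
  ; acyclic    = acyclic ∘ cycle-mono S′⊆S }
  where open IsLinearForest lf

module _ {n} {S : EdgeSet n} where

  first last : Path S → Fin n
  first P = Path.vtx P zero
  last  P = Path.vtx P (fromℕ (Path.len P))

  _⊆ₚ_ : Path S → Path S → Set
  P ⊆ₚ Q = ∀ {x} → OnPath P x → OnPath Q x

  IsComponent : Path S → Set
  IsComponent P = ∀ a b → T (S a b) → OnPath P a ⊎ OnPath P b → PathEdge P a b

  path-len< : (P : Path S) → Path.len P < n
  path-len< P = injective⇒≤ (Path.inj P)

  pathEdge-out-unique : (P : Path S) → ∀ {u v w} → PathEdge P u v → PathEdge P u w → v ≡ w
  pathEdge-out-unique P (i , u≡ , v≡) (j , u≡′ , w≡)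
    with refl ← inject₁-injective (Path.inj P (trans (sym u≡) u≡′)) = trans v≡ (sym w≡)

  pathEdge-in-unique : (P : Path S) → ∀ {u v w} → PathEdge P u w → PathEdge P v w → u ≡ v
  pathEdge-in-unique P (i , u≡ , w≡) (j , v≡ , w≡′)
    with refl ← Path.inj P (trans (sym w≡) w≡′) = trans u≡ (sym v≡)

  component-successor : (P : Path S) → IsComponent P → ∀ {a b p} → T (S a b) → Path.vtx P p ≡ a →
                        ∃ λ q → Path.vtx P q ≡ b × toℕ q ≡ suc (toℕ p)
  component-successor P comp s p↦a with comp _ _ s (inj₁ (_ , p↦a))
  ... | i , a≡ , b≡ with refl ← Path.inj P (trans p↦a a≡) = suc i , sym b≡ , cong suc (sym (toℕ-inject₁ i))

  component-walk : (P : Path S) → IsComponent P → ∀ m (vt : Fin (suc m) → Fin n) →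
                   (∀ i → T (S (vt (inject₁ i)) (vt (suc i)))) → ∀ {p} → Path.vtx P p ≡ vt zero →
                   ∃ λ q → Path.vtx P q ≡ vt (fromℕ m) × toℕ q ≡ toℕ p + m
  component-walk P comp zero    vt es p↦ = _ , p↦ , sym (+-identityʳ _)
  component-walk P comp (suc m) vt es {p} p↦
    with p′ , p′↦ , p′≡ ← component-successor P comp (es zero) p↦
    with q , q↦ , q≡ ← component-walk P comp m (vt ∘ suc) (es ∘ suc) p′↦
    = q , q↦ , trans q≡ (trans (cong (_+ m) p′≡) (sym (+-suc (toℕ p) m)))

  -- Walking once around a cycle would advance the position along P by len + 1.
  cycle-off-component : (P : Path S) → IsComponent P → (c : Cycle S) → ¬ OnPath P (Cycle.vtx c zero)
  cycle-off-component P comp c (p , p↦)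
    with q , q↦ , q≡ ← component-walk P comp (Cycle.len c) (Cycle.vtx c) (Cycle.edges c) p↦
    with r , r↦ , r≡ ← component-successor P comp (Cycle.close c) q↦
    = m≢1+m+n (toℕ p) (trans (cong toℕ (Path.inj P (trans p↦ (sym r↦)))) (trans r≡ (cong suc q≡)))

multipath⇒isLinearForest : ∀ {n} {V : Fin n → Bool} {E S : EdgeSet n} →
  (∀ {u v} → T (S u v) → T (V u) × T (V v)) → IsMultipath V E S → IsLinearForest S
multipath⇒isLinearForest ends (_ , component) = record
  { out-unique = λ s t → let P , u∈P , comp = component _ (proj₁ (ends s))
                         in pathEdge-out-unique P (comp _ _ s (inj₁ u∈P)) (comp _ _ t (inj₁ u∈P))
  ; in-unique  = λ s t → let P , w∈P , comp = component _ (proj₂ (ends s))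
                         in pathEdge-in-unique P (comp _ _ s (inj₂ w∈P)) (comp _ _ t (inj₂ w∈P))
  ; acyclic    = λ c → let P , v∈P , comp = component _ (proj₂ (ends (Cycle.close c)))
                       in cycle-off-component P comp c v∈P }

module ComponentPath {n} {S : EdgeSet n} (lf : IsLinearForest S) where
  open IsLinearForest lf

  NoIn NoOut : Path S → Set
  NoIn  P = ∀ y → ¬ T (S y (first P))
  NoOut P = ∀ z → ¬ T (S (last P) z)

  singleton : Fin n → Path S
  singleton v = record { len = 0 ; vtx = λ _ → v ; inj = λ { {zero} {zero} _ → refl } ; edges = λ () }

  cons : (P : Path S) → ∀ {y} → T (S y (first P)) → Path S
  cons P {y} s = record
    { len = suc (Path.len P) ; vtx = insertAt (Path.vtx P) zero y
    ; inj = insertAt-injective (Path.vtx P) zero y (Path.inj P) fresh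
    ; edges = λ { zero → s ; (suc i) → Path.edges P i } }
    where
    fresh : ∀ j → Path.vtx P j ≢ y
    fresh j j↦y with fromℕ-or-inject₁ j
    ... | inj₁ refl = acyclic (record
      { len = Path.len P ; vtx = Path.vtx P ; inj = Path.inj P ; edges = Path.edges P
      ; close = subst (λ x → T (S x (first P))) (sym j↦y) s })
    ... | inj₂ (i , refl) =
      0≢1+n (Path.inj P (out-unique s (subst (λ x → T (S x _)) j↦y (Path.edges P i))))

  snoc : (P : Path S) → NoIn P → ∀ {z} → T (S (last P) z) → Path S
  snoc P noIn {z} s = record
    { len = suc (Path.len P) ; vtx = vt
    ; inj = insertAt-injective (Path.vtx P) (fromℕ _) z (Path.inj P) fresh
    ; edges = edges }
    where
    vt = insertAt (Path.vtx P) (fromℕ (suc (Path.len P))) z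

    fresh : ∀ j → Path.vtx P j ≢ z
    fresh zero    j↦z = noIn _ (subst (λ x → T (S (last P) x)) (sym j↦z) s)
    fresh (suc j) j↦z =
      let jz = subst (λ x → T (S (Path.vtx P (inject₁ j)) x)) j↦z (Path.edges P j)
      in fromℕ≢inject₁ (sym (Path.inj P (in-unique jz s)))

    edges : ∀ i → T (S (vt (inject₁ i)) (vt (suc i)))
    edges i with fromℕ-or-inject₁ i
    ... | inj₁ refl = subst₂ (λ a b → T (S a b))
      (sym (insertAt-fromℕ-inject₁ (Path.vtx P) z (fromℕ _)))
      (sym (insertAt-lookup (Path.vtx P) (fromℕ (suc (Path.len P))) z)) s
    ... | inj₂ (j , refl) = subst₂ (λ a b → T (S a b))
      (sym (insertAt-fromℕ-inject₁ (Path.vtx P) z (inject₁ j)))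
      (sym (insertAt-fromℕ-inject₁ (Path.vtx P) z (suc j))) (Path.edges P j)

  Extension : (Path S → Set) → Path S → Set
  Extension Inv P = Σ (Path S) λ P′ → Path.len P′ ≡ suc (Path.len P) × P ⊆ₚ P′ × Inv P′

  -- Fuel n suffices: paths in S have fewer than n edges (path-len<).
  extend : ∀ {Inv Done : Path S → Set} → (∀ P → Inv P → Done P ⊎ Extension Inv P) →
           ∀ fuel P → Inv P → n ≤ Path.len P + fuel → Σ (Path S) λ Q → P ⊆ₚ Q × Inv Q × Done Q
  extend step zero P inv bound = ⊥-elim (<⇒≱ (path-len< P) (subst (n ≤_) (+-identityʳ _) bound))
  extend step (suc fuel) P inv bound with step P inv
  ... | inj₁ done = P , (λ x∈P → x∈P) , inv , done
  ... | inj₂ (P′ , len≡ , P⊆P′ , inv′)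
    with Q , P′⊆Q , invQ , doneQ ← extend step fuel P′ inv′
           (subst (n ≤_) (trans (+-suc _ fuel) (cong (_+ fuel) (sym len≡))) bound)
    = Q , (λ x∈P → P′⊆Q (P⊆P′ x∈P)) , invQ , doneQ

  extend-backward : ∀ P → Σ (Path S) λ Q → P ⊆ₚ Q × NoIn Q
  extend-backward P =
    let Q , P⊆Q , _ , noIn = extend step n P tt (m≤n+m n _) in Q , P⊆Q , noIn
    where
    step : ∀ P → ⊤ → NoIn P ⊎ Extension (λ _ → ⊤) P
    step P _ with any? (λ y → T? (S y (first P)))
    ... | no ¬pred    = inj₁ λ y s → ¬pred (y , s)
    ... | yes (y , s) = inj₂ (cons P s , refl , (λ { (j , j↦) → suc j , j↦ }) , tt)

  extend-forward : ∀ P → NoIn P → Σ (Path S) λ Q → P ⊆ₚ Q × NoIn Q × NoOut Q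
  extend-forward P noIn = extend step n P noIn (m≤n+m n _)
    where
    step : ∀ P → NoIn P → NoOut P ⊎ Extension NoIn P
    step P noIn with any? (λ z → T? (S (last P) z))
    ... | no ¬succ    = inj₁ λ z s → ¬succ (z , s)
    ... | yes (z , s) = inj₂ (snoc P noIn s , refl
                             , (λ { (j , j↦) → inject₁ j , trans (insertAt-fromℕ-inject₁ (Path.vtx P) z j) j↦ })
                             , noIn)

  maximal-isComponent : (P : Path S) → NoIn P → NoOut P → IsComponent P
  maximal-isComponent P noIn noOut a b s (inj₁ (j , j↦a)) with fromℕ-or-inject₁ j
  ... | inj₁ refl       = ⊥-elim (noOut b (subst (λ x → T (S x b)) (sym j↦a) s))
  ... | inj₂ (i , refl) = i , sym j↦a , out-unique (subst (λ x → T (S x b)) (sym j↦a) s) (Path.edges P i)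
  maximal-isComponent P noIn noOut a b s (inj₂ (zero , j↦b)) =
    ⊥-elim (noIn a (subst (λ x → T (S a x)) (sym j↦b) s))
  maximal-isComponent P noIn noOut a b s (inj₂ (suc i , j↦b)) =
    i , in-unique (subst (λ x → T (S a x)) (sym j↦b) s) (Path.edges P i) , sym j↦b

  component-through : ∀ v → Σ (Path S) λ P → OnPath P v × IsComponent P
  component-through v =
    let Q , v∈Q , noInQ          = extend-backward (singleton v)
        P , Q⊆P , noIn , noOut = extend-forward Q noInQ
    in P , Q⊆P (v∈Q (zero , refl)) , maximal-isComponent P noIn noOut

isLinearForest⇒multipath : ∀ {n} {V : Fin n → Bool} {E S : EdgeSet n} →
  S ⊆ₑ E → IsLinearForest S → IsMultipath V E S
isLinearForest⇒multipath S⊆E lf = S⊆E , λ v _ → component-through v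
  where open ComponentPath lf

-- Coupled arcs and dynamical regions

module Coupling {n} (G : Digraph n) where

  Arc : Set
  Arc = Fin n × Fin n

  IsArc : Arc → Set
  IsArc (a , b) = T (Digraph.edge G a b)

  _∈ₐ_ : Arc → Subgraph G → Set
  (a , b) ∈ₐ R = T (edge R a b)

  OnSomeCycle : Fin n → Set
  OnSomeCycle v = Σ (Cycle (Digraph.edge G)) λ c → OnCycle c v

  data Coupled : Arc → Arc → Set where
    same-source     : ∀ {u v w} → Coupled (u , v) (u , w)
    same-target     : ∀ {u v w} → Coupled (u , w) (v , w)
    through-cycle   : ∀ {u v w} → OnSomeCycle v → Coupled (u , v) (v , w)
    through-cycle⁻¹ : ∀ {u v w} → OnSomeCycle v → Coupled (v , w) (u , v)

  _∼_ : Arc → Arc → Set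
  e ∼ f = IsArc e × IsArc f × Coupled e f

  _∼⋆_ : Arc → Arc → Set
  _∼⋆_ = Star _∼_

  ∼-sym : ∀ {e f} → e ∼ f → f ∼ e
  ∼-sym (e , f , same-source)       = f , e , same-source
  ∼-sym (e , f , same-target)       = f , e , same-target
  ∼-sym (e , f , through-cycle o)   = f , e , through-cycle⁻¹ o
  ∼-sym (e , f , through-cycle⁻¹ o) = f , e , through-cycle o

  ∼⋆-sym : ∀ {e f} → e ∼⋆ f → f ∼⋆ e
  ∼⋆-sym = reverse ∼-sym

  ∼⋆-isArc : ∀ {e f} → e ∼⋆ f → IsArc e → IsArc f
  ∼⋆-isArc ε                     e = e
  ∼⋆-isArc ((_ , f , _) ◅ f∼⋆g) _ = ∼⋆-isArc f∼⋆g f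

  private
    first-arc-∼⋆ : ∀ m (vt : Fin (suc (suc m)) → Fin n) →
                   (∀ i → IsArc (vt (inject₁ i) , vt (suc i))) → (∀ j → OnSomeCycle (vt j)) →
                   ∀ i → (vt zero , vt (suc zero)) ∼⋆ (vt (inject₁ i) , vt (suc i))
    first-arc-∼⋆ m       vt arcs on zero = ε
    first-arc-∼⋆ (suc m) vt arcs on (suc i) =
      (arcs zero , arcs (suc zero) , through-cycle (on (suc zero)))
      ◅ first-arc-∼⋆ m (vt ∘ suc) (arcs ∘ suc) (on ∘ suc) i

    arc-∼⋆-closing : ∀ m (vt : Fin (suc m) → Fin n) →
                     (∀ i → IsArc (vt (inject₁ i) , vt (suc i))) → IsArc (vt (fromℕ m) , vt zero) →
                     (∀ j → OnSomeCycle (vt j)) →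
                     ∀ i → (vt (inject₁ i) , vt (suc i)) ∼⋆ (vt (fromℕ m) , vt zero)
    arc-∼⋆-closing (suc m) vt arcs close on i =
      ∼⋆-sym (first-arc-∼⋆ m vt arcs on i) ◅◅ ∼-sym (close , arcs zero , through-cycle (on zero)) ◅ ε

  cycle-arc-∼⋆-closing : (c : Cycle (Digraph.edge G)) → ∀ {a b} → CycleEdge c a b →
                         (a , b) ∼⋆ (Cycle.vtx c (fromℕ (Cycle.len c)) , Cycle.vtx c zero)
  cycle-arc-∼⋆-closing c (inj₁ (i , refl , refl)) =
    arc-∼⋆-closing (Cycle.len c) (Cycle.vtx c) (Cycle.edges c) (Cycle.close c) (λ j → c , j , refl) i
  cycle-arc-∼⋆-closing c (inj₂ (refl , refl)) = ε

  cycle-arcs-∼⋆ : (c : Cycle (Digraph.edge G)) → ∀ {a b a′ b′} →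
                  CycleEdge c a b → CycleEdge c a′ b′ → (a , b) ∼⋆ (a′ , b′)
  cycle-arcs-∼⋆ c ab ab′ = cycle-arc-∼⋆-closing c ab ◅◅ ∼⋆-sym (cycle-arc-∼⋆-closing c ab′)

  module _ (R : Subgraph G) (region : DynRegion R) where
    private
      boundary-condition = proj₁ (proj₂ (proj₂ region))
      cycle-condition    = proj₂ (proj₂ (proj₂ region))

    in-region-or-complement : ∀ {a b} → T (Digraph.edge G a b) → T (edge R a b) ⊎ T (compEdge R a b)
    in-region-or-complement {a} {b} ab with edge R a b
    ... | true  = inj₁ tt
    ... | false = inj₂ (subst T (sym (∧-identityʳ _)) ab)

    -- If uw were outside R, u would be a boundary vertex whose out-arcs uv ∈ R and uw ∈ C_G(R)
    -- leave it no in-arcs in either, so u would be stable in G.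
    region-closed-source : ∀ {u v w} → T (edge R u v) → T (Digraph.edge G u w) → T (edge R u w)
    region-closed-source {u} {v} {w} uv uw with in-region-or-complement uw
    ... | inj₁ uw∈R = uw∈R
    ... | inj₂ uw∈C with boundary-condition u (src∈ R u v uv , w , inj₁ uw∈C)
    ... | _ , inj₂ no-out-R , _ = ⊥-elim (no-out-R v uv)
    ... | _ , inj₁ _ , inj₂ no-out-C = ⊥-elim (no-out-C w uw∈C)
    ... | unstable , inj₁ no-in-R , inj₁ no-in-C =
      ⊥-elim (unstable (inj₁ λ x xu → [ no-in-R x , no-in-C x ] (in-region-or-complement xu)))

    region-closed-target : ∀ {u v w} → T (edge R u w) → T (Digraph.edge G v w) → T (edge R v w)
    region-closed-target {u} {v} {w} uw vw with in-region-or-complement vw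
    ... | inj₁ vw∈R = vw∈R
    ... | inj₂ vw∈C with boundary-condition w (tgt∈ R u w uw , v , inj₂ vw∈C)
    ... | _ , inj₁ no-in-R , _ = ⊥-elim (no-in-R u uw)
    ... | _ , inj₂ _ , inj₁ no-in-C = ⊥-elim (no-in-C v vw∈C)
    ... | unstable , inj₂ no-out-R , inj₂ no-out-C =
      ⊥-elim (unstable (inj₂ λ x wx → [ no-out-R x , no-out-C x ] (in-region-or-complement wx)))

    region-closed-∼ : ∀ {e f} → e ∼ f → e ∈ₐ R → f ∈ₐ R
    region-closed-∼ (_ , f , same-source) e∈R = region-closed-source e∈R f
    region-closed-∼ (_ , f , same-target) e∈R = region-closed-target e∈R f
    region-closed-∼ (_ , f , through-cycle (c , j , refl)) e∈R =
      let _ , uv = cycle-in-arc c j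
          _ , vw = cycle-out-arc c j
          uv∈R   = region-closed-target e∈R (cycleEdge-edge c uv)
      in region-closed-source (cycle-condition _ _ uv∈R c uv _ _ vw) f
    region-closed-∼ (_ , f , through-cycle⁻¹ (c , j , refl)) e∈R =
      let _ , uv = cycle-in-arc c j
          _ , vw = cycle-out-arc c j
          vw∈R   = region-closed-source e∈R (cycleEdge-edge c vw)
      in region-closed-target (cycle-condition _ _ vw∈R c vw _ _ uv) f

    region-closed-∼⋆ : ∀ {e f} → e ∼⋆ f → e ∈ₐ R → f ∈ₐ R
    region-closed-∼⋆ ε               e∈R = e∈R
    region-closed-∼⋆ (e∼f ◅ f∼⋆g) e∈R = region-closed-∼⋆ f∼⋆g (region-closed-∼ e∼f e∈R)

  module Generated (e₀ : Arc) (e₀-arc : IsArc e₀) (reach? : ∀ a b → Dec (e₀ ∼⋆ (a , b))) where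

    reach-isArc : ∀ {f} → e₀ ∼⋆ f → IsArc f
    reach-isArc e₀∼⋆f = ∼⋆-isArc e₀∼⋆f e₀-arc

    ⟨e₀⟩ : Subgraph G
    ⟨e₀⟩ = record
      { vert  = λ v → isYes (any? λ w → reach? v w ⊎-dec reach? w v)
      ; edge  = λ a b → isYes (reach? a b)
      ; edge⊆ = λ _ _ → reach-isArc ∘ toWitness
      ; src∈  = λ _ b ab → fromWitness (b , inj₁ (toWitness ab))
      ; tgt∈  = λ a _ ab → fromWitness (a , inj₂ (toWitness ab)) }

    e₀∈⟨e₀⟩ : e₀ ∈ₐ ⟨e₀⟩
    e₀∈⟨e₀⟩ = fromWitness ε

    private
      Walk : Fin n → Fin n → Set
      Walk = Star (Adj (edge ⟨e₀⟩))

      arc-walk : ∀ {a b} → e₀ ∼⋆ (a , b) → Walk a b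
      arc-walk e₀∼⋆ab = inj₁ (fromWitness e₀∼⋆ab) ◅ ε

      arc-walk⁻¹ : ∀ {a b} → e₀ ∼⋆ (a , b) → Walk b a
      arc-walk⁻¹ e₀∼⋆ab = inj₂ (fromWitness e₀∼⋆ab) ◅ ε

      coupled-walk : ∀ {e f} → e₀ ∼⋆ e → e ∼ f → Walk (proj₁ e) (proj₁ f)
      coupled-walk e₀∼⋆e     (_ , _ , same-source)       = ε
      coupled-walk e₀∼⋆e e∼f@(_ , _ , same-target)       = arc-walk e₀∼⋆e ◅◅ arc-walk⁻¹ (e₀∼⋆e ◅◅ e∼f ◅ ε)
      coupled-walk e₀∼⋆e     (_ , _ , through-cycle _)   = arc-walk e₀∼⋆e
      coupled-walk e₀∼⋆e e∼f@(_ , _ , through-cycle⁻¹ _) = arc-walk⁻¹ (e₀∼⋆e ◅◅ e∼f ◅ ε)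

      source-walk : ∀ {e f} → e₀ ∼⋆ e → e ∼⋆ f → Walk (proj₁ e) (proj₁ f)
      source-walk e₀∼⋆e ε             = ε
      source-walk e₀∼⋆e (e∼f ◅ f∼⋆g) = coupled-walk e₀∼⋆e e∼f ◅◅ source-walk (e₀∼⋆e ◅◅ e∼f ◅ ε) f∼⋆g

      walk-to-reached-source : ∀ {x} → T (vert ⟨e₀⟩ x) → ∃ λ f → e₀ ∼⋆ f × Walk x (proj₁ f)
      walk-to-reached-source x∈ with toWitness x∈
      ... | _ , inj₁ e₀∼⋆xw = _ , e₀∼⋆xw , ε
      ... | _ , inj₂ e₀∼⋆wx = _ , e₀∼⋆wx , arc-walk⁻¹ e₀∼⋆wx

      Walk-sym : ∀ {x y} → Walk x y → Walk y x
      Walk-sym = reverse λ { (inj₁ xy) → inj₂ xy ; (inj₂ yx) → inj₁ yx }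

    ⟨e₀⟩-connected : Connected (vert ⟨e₀⟩) (edge ⟨e₀⟩)
    ⟨e₀⟩-connected x y x∈ y∈ =
      let f , e₀∼⋆f , x⇝f = walk-to-reached-source x∈
          g , e₀∼⋆g , y⇝g = walk-to-reached-source y∈
      in x⇝f ◅◅ Walk-sym (source-walk ε e₀∼⋆f) ◅◅ source-walk ε e₀∼⋆g ◅◅ Walk-sym y⇝g

    private
      complement-arc : ∀ {a b} → T (compEdge ⟨e₀⟩ a b) → IsArc (a , b) × ¬ e₀ ∼⋆ (a , b)
      complement-arc ab∈C = let ab , unreached = Equivalence.to T-∧ ab∈C in ab , toWitnessFalse unreached

      reach-same-source : ∀ {v w x} → e₀ ∼⋆ (v , w) → IsArc (v , x) → e₀ ∼⋆ (v , x)
      reach-same-source e₀∼⋆vw vx = e₀∼⋆vw ◅◅ (reach-isArc e₀∼⋆vw , vx , same-source) ◅ ε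

      reach-same-target : ∀ {v w x} → e₀ ∼⋆ (w , v) → IsArc (x , v) → e₀ ∼⋆ (x , v)
      reach-same-target e₀∼⋆wv xv = e₀∼⋆wv ◅◅ (reach-isArc e₀∼⋆wv , xv , same-target) ◅ ε

    -- Arcs of ⟨e₀⟩ and of its complement never share a source or a target, so they meet head to tail.
    ⟨e₀⟩-boundary : ∀ v → Boundary ⟨e₀⟩ v →
                    Unstable (Digraph.edge G) v × Stable (edge ⟨e₀⟩) v × Stable (compEdge ⟨e₀⟩) v
    ⟨e₀⟩-boundary v (v∈ , x , vx-or-xv) with toWitness v∈ | vx-or-xv
    ... | w , inj₁ e₀∼⋆vw | inj₁ vx∈C =
      let vx , unreached = complement-arc vx∈C in ⊥-elim (unreached (reach-same-source e₀∼⋆vw vx))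
    ... | w , inj₂ e₀∼⋆wv | inj₂ xv∈C =
      let xv , unreached = complement-arc xv∈C in ⊥-elim (unreached (reach-same-target e₀∼⋆wv xv))
    ... | w , inj₂ e₀∼⋆wv | inj₁ vx∈C =
      let vx , unreached = complement-arc vx∈C in
        [ (λ no-in → no-in w (reach-isArc e₀∼⋆wv)) , (λ no-out → no-out x vx) ]
      , inj₂ (λ y vy → unreached (reach-same-source (toWitness vy) vx))
      , inj₁ (λ y yv∈C → let yv , unreached′ = complement-arc yv∈C in
                          unreached′ (reach-same-target e₀∼⋆wv yv))
    ... | w , inj₁ e₀∼⋆vw | inj₂ xv∈C =
      let xv , unreached = complement-arc xv∈C in
        [ (λ no-in → no-in x xv) , (λ no-out → no-out w (reach-isArc e₀∼⋆vw)) ]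
      , inj₁ (λ y yv → unreached (reach-same-target (toWitness yv) xv))
      , inj₂ (λ y vy∈C → let vy , unreached′ = complement-arc vy∈C in
                          unreached′ (reach-same-source e₀∼⋆vw vy))

    ⟨e₀⟩-isDynRegion : DynRegion ⟨e₀⟩
    ⟨e₀⟩-isDynRegion =
        ⟨e₀⟩-connected
      , (proj₁ e₀ , proj₂ e₀ , e₀∈⟨e₀⟩)
      , ⟨e₀⟩-boundary
      , λ _ _ ab c ab-on-c _ _ a′b′-on-c → fromWitness (toWitness ab ◅◅ cycle-arcs-∼⋆ c ab-on-c a′b′-on-c)

    ⟨e₀⟩-least : ∀ R → DynRegion R → e₀ ∈ₐ R → ⟨e₀⟩ ≤ₛ R
    ⟨e₀⟩-least R region e₀∈R = vert≤ , λ _ _ ab → region-closed-∼⋆ R region (toWitness ab) e₀∈R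
      where
      vert≤ : ∀ v → T (vert ⟨e₀⟩ v) → T (vert R v)
      vert≤ v v∈ with toWitness v∈
      ... | w , inj₁ e₀∼⋆vw = src∈ R v w (region-closed-∼⋆ R region e₀∼⋆vw e₀∈R)
      ... | w , inj₂ e₀∼⋆wv = tgt∈ R w v (region-closed-∼⋆ R region e₀∼⋆wv e₀∈R)

    ⟨e₀⟩-isDynModule : DynModule ⟨e₀⟩
    ⟨e₀⟩-isDynModule = ⟨e₀⟩-isDynRegion , minimal
      where
      minimal : ∀ R → DynRegion R → R ≤ₛ ⟨e₀⟩ → R ≈ₛ ⟨e₀⟩
      minimal R region R≤ with a , b , ab∈R ← proj₁ (proj₂ region) =
        ≤ₛ-antisym {R = R} {R′ = ⟨e₀⟩} R≤ (⟨e₀⟩-least R region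
          (region-closed-∼⋆ R region (∼⋆-sym (toWitness (proj₂ R≤ a b ab∈R))) ab∈R))

-- The dynamical modules partition the arcs

module _ {n} {G : Digraph n} where
  open Coupling G

  -- ∼⋆ is decidable only classically, but both conclusions below are decidable,
  -- so they may be proved under a double negation.
  private
    ¬¬-reach? : ∀ e → ¬ ¬ (∀ a b → Dec (e ∼⋆ (a , b)))
    ¬¬-reach? e = ¬¬-∀-Fin n λ a → ¬¬-∀-Fin n λ b → ¬¬-excluded-middle

  arc-in-some-module : ∀ {k} (Gs : Fin k → Subgraph G) → (∀ R → DynModule R → ∃[ i ] (R ≈ₛ Gs i)) →
                       ∀ u v → T (Digraph.edge G u v) → ∃ λ i → T (edge (Gs i) u v)
  arc-in-some-module Gs complete u v uv = decidable-stable (any? λ i → T? (edge (Gs i) u v)) λ ¬∃ →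
    ¬¬-reach? (u , v) λ reach? →
      let open Generated (u , v) uv reach?
          i , ⟨uv⟩≈Gsᵢ = complete ⟨e₀⟩ ⟨e₀⟩-isDynModule
      in ¬∃ (i , subst T (proj₂ ⟨uv⟩≈Gsᵢ u v) e₀∈⟨e₀⟩)

  arc-in-unique-module : ∀ {k} (Gs : Fin k → Subgraph G) → (∀ i → DynModule (Gs i)) →
                         (∀ i j → Gs i ≈ₛ Gs j → i ≡ j) →
                         ∀ i j u v → T (edge (Gs i) u v) → T (edge (Gs j) u v) → i ≡ j
  arc-in-unique-module Gs modules distinct i j u v uv∈i uv∈j = decidable-stable (i ≟ j) λ i≢j →
    ¬¬-reach? (u , v) λ reach? →
      let open Generated (u , v) (edge⊆ (Gs i) u v uv∈i) reach?
          ⟨uv⟩≈Gs : ∀ l → T (edge (Gs l) u v) → ⟨e₀⟩ ≈ₛ Gs l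
          ⟨uv⟩≈Gs l uv∈l = proj₂ (modules l) ⟨e₀⟩ ⟨e₀⟩-isDynRegion (⟨e₀⟩-least (Gs l) (proj₁ (modules l)) uv∈l)
      in i≢j (distinct i j (≈ₛ-trans {R = Gs i} {R′ = ⟨e₀⟩} {R″ = Gs j}
                              (≈ₛ-sym {R = ⟨e₀⟩} {R′ = Gs i} (⟨uv⟩≈Gs i uv∈i)) (⟨uv⟩≈Gs j uv∈j)))

-- The decomposition of multipaths

module DirectSum {n} {G : Digraph n} {k} (Gs : Fin k → Subgraph G)
  (regions   : ∀ i → DynRegion (Gs i))
  (in-some   : ∀ u v → T (Digraph.edge G u v) → ∃ λ i → T (edge (Gs i) u v))
  (in-unique : ∀ i j u v → T (edge (Gs i) u v) → T (edge (Gs j) u v) → i ≡ j) where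
  open Coupling G

  multipath-split : ∀ {S} → IsMultipath allV (Digraph.edge G) S →
                    ∀ i → IsMultipath (vert (Gs i)) (edge (Gs i)) (S ∩ₑ edge (Gs i))
  multipath-split mp i =
    isLinearForest⇒multipath (λ _ _ → proj₂ ∘ Equivalence.to T-∧)
      (isLinearForest-mono (λ _ _ → proj₁ ∘ Equivalence.to T-∧) (multipath⇒isLinearForest (λ _ → tt , tt) mp))

  split-covers : ∀ {S} → S ⊆ₑ Digraph.edge G → ∀ u v → T (S u v) ⇔ ∃ λ i → T ((S ∩ₑ edge (Gs i)) u v)
  split-covers S⊆G u v = mk⇔
    (λ uv → let i , uv∈i = in-some u v (S⊆G u v uv) in i , Equivalence.from T-∧ (uv , uv∈i))
    (λ (_ , uv∈Sᵢ) → proj₁ (Equivalence.to T-∧ uv∈Sᵢ))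

  multipath-glue : ∀ {S} → S ⊆ₑ Digraph.edge G → (I : Fin k → EdgeSet n) →
                   (∀ i → IsMultipath (vert (Gs i)) (edge (Gs i)) (I i)) →
                   (∀ u v → T (S u v) ⇔ ∃ λ i → T (I i u v)) → IsMultipath allV (Digraph.edge G) S
  multipath-glue {S} S⊆G I multipaths S⇔ = isLinearForest⇒multipath S⊆G record
    { out-unique = out-unique
    ; in-unique  = in-unique′
    ; acyclic    = acyclic }
    where
    Iᵢ⊆Gsᵢ : ∀ {i u v} → T (I i u v) → T (edge (Gs i) u v)
    Iᵢ⊆Gsᵢ {i} = proj₁ (multipaths i) _ _

    forest : ∀ i → IsLinearForest (I i)
    forest i = multipath⇒isLinearForest
      (λ uv → src∈ (Gs i) _ _ (Iᵢ⊆Gsᵢ uv) , tgt∈ (Gs i) _ _ (Iᵢ⊆Gsᵢ uv)) (multipaths i)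

    piece : ∀ {u v} → T (S u v) → ∃ λ i → T (I i u v)
    piece = Equivalence.to (S⇔ _ _)

    reindex : ∀ {i j u v} → T (I j u v) → T (edge (Gs i) u v) → T (I i u v)
    reindex {i} {j} {u} {v} uv∈Iⱼ uv∈i =
      subst (λ l → T (I l u v)) (in-unique j i u v (Iᵢ⊆Gsᵢ uv∈Iⱼ) uv∈i) uv∈Iⱼ

    out-unique : ∀ {u v w} → T (S u v) → T (S u w) → v ≡ w
    out-unique uv uw with i , uv∈Iᵢ ← piece uv | _ , uw∈Iⱼ ← piece uw =
      IsLinearForest.out-unique (forest i) uv∈Iᵢ
        (reindex uw∈Iⱼ (region-closed-source (Gs i) (regions i) (Iᵢ⊆Gsᵢ uv∈Iᵢ) (S⊆G _ _ uw)))

    in-unique′ : ∀ {u v w} → T (S u w) → T (S v w) → u ≡ v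
    in-unique′ uw vw with i , uw∈Iᵢ ← piece uw | _ , vw∈Iⱼ ← piece vw =
      IsLinearForest.in-unique (forest i) uw∈Iᵢ
        (reindex vw∈Iⱼ (region-closed-target (Gs i) (regions i) (Iᵢ⊆Gsᵢ uw∈Iᵢ) (S⊆G _ _ vw)))

    -- The whole cycle lies in the module of its closing arc, by condition (b) on regions.
    acyclic : ¬ Cycle S
    acyclic c with i , close∈Iᵢ ← piece (Cycle.close c) =
      IsLinearForest.acyclic (forest i) (cycle-restrict c λ ab-on-c →
        reindex (proj₂ (piece (cycleEdge-edge c ab-on-c)))
          (proj₂ (proj₂ (proj₂ (regions i))) _ _ (Iᵢ⊆Gsᵢ close∈Iᵢ) (cycle-mono S⊆G c) (inj₂ (refl , refl)) _ _ ab-on-c))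

corollary4p20 : ∀ {n : ℕ} (G : Digraph n) → MPDigraph G
    → Connected allV (Digraph.edge G)
    → (k : ℕ) (Gs : Fin k → Subgraph G)
    → (∀ i → DynModule (Gs i))
    → (∀ (R : Subgraph G) → DynModule R → ∃[ i ] (R ≈ₛ Gs i))
    → (∀ i j → Gs i ≈ₛ Gs j → i ≡ j)
    → DirectSumOfModules G k Gs
corollary4p20 G _ _ k Gs modules complete distinct =
    arc-in-some-module Gs complete
  , arc-in-unique-module Gs modules distinct
  , λ S S⊆G → mk⇔
      (λ mp → (λ i → S ∩ₑ edge (Gs i)) , multipath-split mp , split-covers S⊆G)
      (λ (I , multipaths , S⇔) → multipath-glue S⊆G I multipaths S⇔)
  where
  open DirectSum Gs (proj₁ ∘ modules) (arc-in-some-module Gs complete)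
                    (arc-in-unique-module Gs modules distinct)
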